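{- Let $X$ and $Y$ be $d$-dimensional simplicial complexes in which every simplex is contained in a $d$-simplex. Let $F\colon X\to Y$ be a simplicial map and $C\subset X^{(0)}$ a set of vertices such that: (i) a subset $U=\{x_0,\dots,x_d\}\subset X^{(0)}$ is a $d$-simplex of $X$ if and only if $F(U)$ is a $d$-simplex of $Y$ and $U\cap C\neq\emptyset$; and (ii) for each $d$-simplex $\tau$ of $Y$ there exists $U\subset C$ with $F(U)=\tau$. Then $X$ is fibered over $Y$ by $F$ with core $C$.
   Context: $X$ is fibered over $Y$ by $F$ with core $C$ if $F(C)=Y^{(0)}$ and: a subset $U=\{x_0,\dots,x_k\}\subset X^{(0)}$ is a $k$-simplex of $X$ if and only if (1) $F(U)=\{F(x_0),\dots,F(x_k)\}$ is a $k$-simplex of $Y$, and (2) if $F(U)$ is a maximal simplex of $Y$ then $U\cap C\neq\emptyset$. -}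

module Defs where

open import Data.Nat using (ℕ; suc; _≤_)
open import Data.List using (List; []; _∷_; [_]; length)
open import Data.List.Membership.Propositional using (_∈_)
open import Data.List.Relation.Binary.Subset.Propositional using (_⊆_)
open import Data.List.Relation.Binary.Permutation.Propositional using (_↭_)
open import Data.List.Relation.Unary.Unique.Propositional using (Unique)
open import Data.Product using (Σ; ∃; _×_; _,_)
open import Relation.Binary.PropositionalEquality using (_≡_)
open import Function.Bundles using (_⇔_)

-- A simplex is
-- represented by a duplicate-free list of its vertices (a finite set);
-- the predicate is invariant under reordering, contains all vertices
-- and is closed under taking nonempty faces.
record SimplicialComplex : Set₁ where
  field
    V          : Set
    Simplex    : List V → Set
    unique     : ∀ σ → Simplex σ → Unique σ
    nonempty   : ∀ σ → Simplex σ → 0 Data.Nat.< length σ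
    perm       : ∀ σ τ → σ ↭ τ → Simplex σ → Simplex τ
    vertex     : ∀ v → Simplex [ v ]
    face       : ∀ σ τ → Unique τ → 0 Data.Nat.< length τ → τ ⊆ σ → Simplex σ → Simplex τ

open SimplicialComplex public

IsKSimplex : (K : SimplicialComplex) → ℕ → List (V K) → Set
IsKSimplex K k σ = Simplex K σ × length σ ≡ suc k

DimAtMost : (K : SimplicialComplex) → ℕ → Set
DimAtMost K d = ∀ σ → Simplex K σ → length σ ≤ suc d

PureOfDim : (K : SimplicialComplex) → ℕ → Set
PureOfDim K d = ∀ σ → Simplex K σ → ∃ λ τ → IsKSimplex K d τ × σ ⊆ τ

IsImage : {A B : Set} → (A → B) → List A → List B → Set
IsImage {A} {B} F U τ = ∀ (y : B) → (y ∈ τ) ⇔ (∃ λ x → x ∈ U × F x ≡ y)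

ImageIsKSimplex : (X Y : SimplicialComplex) → (V X → V Y) → ℕ → List (V X) → Set
ImageIsKSimplex X Y F k U = ∃ λ τ → IsImage F U τ × IsKSimplex Y k τ

IsMaximal : (K : SimplicialComplex) → List (V K) → Set
IsMaximal K τ = Simplex K τ × (∀ ρ → Simplex K ρ → τ ⊆ ρ → ρ ⊆ τ)

ImageIsMaximal : (X Y : SimplicialComplex) → (V X → V Y) → List (V X) → Set
ImageIsMaximal X Y F U = ∃ λ τ → IsImage F U τ × IsMaximal Y τ

IsSimplicialMap : (X Y : SimplicialComplex) → (V X → V Y) → Set
IsSimplicialMap X Y F = ∀ σ → Simplex X σ → ∃ λ τ → IsImage F σ τ × Simplex Y τ

Meets : {A : Set} → List A → (A → Set) → Set
Meets U C = ∃ λ x → x ∈ U × C x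

FiberedWithCore : (X Y : SimplicialComplex) → (V X → V Y) → (V X → Set) → Set
FiberedWithCore X Y F C =
  (∀ (y : V Y) → ∃ λ x → C x × F x ≡ y)
  × (∀ (k : ℕ) (U : List (V X)) → Unique U → length U ≡ suc k →
       Simplex X U ⇔ (ImageIsKSimplex X Y F k U × (ImageIsMaximal X Y F U → Meets U C)))

{-# OPTIONS --safe #-}
module Submission where

-- Choosing by (ii) a preimage in C of every vertex gives a section c : Y⁽⁰⁾ → C of F.
-- A simplex U of X lies in a d-simplex W, on which F is injective since
-- |F(W)| = d + 1 = |W|; so F(U) has the dimension of U, and if F(U) is maximal then
-- F(W) ⊆ F(U), whence W ⊆ U and U meets C because W does.  Conversely, if F(U) = τ
-- satisfies (1) and (2), extend τ to a d-simplex ρ and add c(ρ ∖ τ) to U.  The result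
-- is mapped bijectively onto ρ and meets C (through c when ρ ≠ τ, and by (2) when
-- τ = ρ, which is then maximal), so it is a d-simplex of X and U is one of its faces.

open import Defs
open import Data.Nat using (ℕ; suc; _≤_; _+_; _<_; z<s)
open import Data.Nat.Properties using (≤-trans; ≤-reflexive; ≤-antisym; m≤m+n; m+1+n≰m; 1+n≰n; +-identityʳ)
open import Data.List using (List; []; _∷_; [_]; _++_; map; length)
open import Data.List.Properties using (length-++; length-map; ++-identityʳ)
open import Data.List.Membership.Propositional using (_∈_; _∉_)
open import Data.List.Membership.Propositional.Properties using (∈-∃++; ∈-++⁺ˡ; ∈-++⁺ʳ; ∈-++⁻; ∈-map⁺; ∈-map⁻)
open import Data.List.Relation.Unary.Any using (here; there)
import Data.List.Relation.Unary.All as All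
import Data.List.Relation.Unary.All.Properties as Allₚ
open import Data.List.Relation.Unary.AllPairs using ([]; _∷_)
open import Data.List.Relation.Binary.Subset.Propositional using (_⊆_)
open import Data.List.Relation.Binary.Disjoint.Propositional using (Disjoint)
open import Data.List.Relation.Binary.Permutation.Propositional using (_↭_; ↭-refl; ↭-prep; ↭-sym; ↭-trans; ↭⇒↭ₛ)
open import Data.List.Relation.Binary.Permutation.Propositional.Properties using (∈-resp-↭; ↭-length; shift)
import Data.List.Relation.Binary.Permutation.Setoid.Properties as Permutationₛ
open import Data.List.Relation.Unary.Unique.Propositional using (Unique)
import Data.List.Relation.Unary.Unique.Propositional.Properties as Unique
open import Data.Product using (∃; _×_; _,_; proj₁; proj₂)
open import Data.Sum using (inj₁; inj₂)
open import Data.Empty using (⊥-elim)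
open import Function using (_∘_)
open import Relation.Binary.PropositionalEquality
  using (_≡_; refl; sym; trans; cong; cong₂; subst; setoid; module ≡-Reasoning)
open import Function.Bundles using (_⇔_; mk⇔; Equivalence)

open Equivalence

module _ {A : Set} where

  ∈⇒↭-∷ : ∀ {x : A} {ys} → x ∈ ys → ∃ λ ys′ → ys ↭ x ∷ ys′
  ∈⇒↭-∷ {x} x∈ys with as , bs , refl ← ∈-∃++ x∈ys = as ++ bs , shift x as bs

  unique-resp-↭ : ∀ {xs ys : List A} → xs ↭ ys → Unique xs → Unique ys
  unique-resp-↭ xs↭ys = Permutationₛ.Unique-resp-↭ (setoid A) (↭⇒↭ₛ xs↭ys)

  length-↭-++ : ∀ {ys} (xs : List A) {zs} → ys ↭ xs ++ zs → length ys ≡ length xs + length zs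
  length-↭-++ xs ys↭ = trans (↭-length ys↭) (length-++ xs)

  unique-++⁻ : ∀ (xs : List A) {ys} → Unique (xs ++ ys) → Unique ys × Disjoint xs ys
  unique-++⁻ [] uys = uys , λ { (() , _) }
  unique-++⁻ (x ∷ xs) (x∉ ∷ u) with uys , xs#ys ← unique-++⁻ xs u = uys , λ where
    (here refl , v∈ys) → All.lookup x∉ (∈-++⁺ʳ xs v∈ys) refl
    (there v∈xs , v∈ys) → xs#ys (v∈xs , v∈ys)

  ∷-⊆-∷⁻ : ∀ {x : A} {xs ys} → x ∉ xs → x ∷ xs ⊆ x ∷ ys → xs ⊆ ys
  ∷-⊆-∷⁻ x∉xs sub z∈xs with sub (there z∈xs)
  ... | here refl = ⊥-elim (x∉xs z∈xs)
  ... | there z∈ys = z∈ys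

  -- The carrier has no decidable equality; the membership proofs locate the elements to remove.
  ⊆⇒↭-++ : ∀ {xs ys : List A} → Unique xs → xs ⊆ ys → ∃ λ zs → ys ↭ xs ++ zs
  ⊆⇒↭-++ {[]} {ys} _ _ = ys , ↭-refl
  ⊆⇒↭-++ {x ∷ xs} ux∷xs@(_ ∷ uxs) x∷xs⊆ys
    with ys′ , ys↭ ← ∈⇒↭-∷ (x∷xs⊆ys (here refl))
    with zs , ys′↭ ← ⊆⇒↭-++ uxs (∷-⊆-∷⁻ (Unique.Unique[x∷xs]⇒x∉xs ux∷xs) (∈-resp-↭ ys↭ ∘ x∷xs⊆ys))
    = zs , ↭-trans ys↭ (↭-prep x ys′↭)

  unique-⊆⇒length-≤ : ∀ {xs ys : List A} → Unique xs → xs ⊆ ys → length xs ≤ length ys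
  unique-⊆⇒length-≤ {xs} uxs xs⊆ys with zs , ys↭ ← ⊆⇒↭-++ uxs xs⊆ys =
    ≤-trans (m≤m+n (length xs) (length zs)) (≤-reflexive (sym (length-↭-++ xs ys↭)))

  unique-⊆-length-≤⇒⊇ : ∀ {xs ys : List A} → Unique xs → xs ⊆ ys → length ys ≤ length xs → ys ⊆ xs
  unique-⊆-length-≤⇒⊇ {xs} uxs xs⊆ys ys≤xs with ⊆⇒↭-++ uxs xs⊆ys
  ... | [] , ys↭ = λ y∈ys → subst (λ l → _ ∈ l) (++-identityʳ xs) (∈-resp-↭ ys↭ y∈ys)
  ... | _ ∷ _ , ys↭ = ⊥-elim (m+1+n≰m (length xs) (subst (_≤ length xs) (length-↭-++ xs ys↭) ys≤xs))

  unique-⊆⊇⇒length-≡ : ∀ {xs ys : List A} → Unique xs → Unique ys → xs ⊆ ys → ys ⊆ xs → length xs ≡ length ys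
  unique-⊆⊇⇒length-≡ uxs uys xs⊆ys ys⊆xs =
    ≤-antisym (unique-⊆⇒length-≤ uxs xs⊆ys) (unique-⊆⇒length-≤ uys ys⊆xs)

InjectiveOn : {A B : Set} → (A → B) → List A → Set
InjectiveOn F U = ∀ {x y} → x ∈ U → y ∈ U → F x ≡ F y → x ≡ y

module _ {A B : Set} (F : A → B) where

  image⊆map : ∀ {U τ} → IsImage F U τ → τ ⊆ map F U
  image⊆map img y∈τ with x , x∈U , refl ← to (img _) y∈τ = ∈-map⁺ F x∈U

  map⊆image : ∀ {U τ} → IsImage F U τ → map F U ⊆ τ
  map⊆image img y∈FU with x , x∈U , refl ← ∈-map⁻ F y∈FU = from (img _) (x , x∈U , refl)

  image-mono : ∀ {U W τ σ} → IsImage F U τ → IsImage F W σ → U ⊆ W → τ ⊆ σ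
  image-mono imgU imgW U⊆W y∈τ with x , x∈U , Fx≡y ← to (imgU _) y∈τ = from (imgW _) (x , U⊆W x∈U , Fx≡y)

  image-++ : ∀ {U W τ σ} → IsImage F U τ → IsImage F W σ → IsImage F (U ++ W) (τ ++ σ)
  image-++ {U} {W} {τ} {σ} imgU imgW y = mk⇔ image→ image←
    where
    image→ : y ∈ τ ++ σ → ∃ λ x → x ∈ U ++ W × F x ≡ y
    image→ y∈ with ∈-++⁻ τ y∈
    ... | inj₁ y∈τ = let x , x∈U , Fx≡y = to (imgU y) y∈τ in x , ∈-++⁺ˡ x∈U , Fx≡y
    ... | inj₂ y∈σ = let x , x∈W , Fx≡y = to (imgW y) y∈σ in x , ∈-++⁺ʳ U x∈W , Fx≡y
    image← : (∃ λ x → x ∈ U ++ W × F x ≡ y) → y ∈ τ ++ σ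
    image← (x , x∈ , Fx≡y) with ∈-++⁻ U x∈
    ... | inj₁ x∈U = ∈-++⁺ˡ (from (imgU y) (x , x∈U , Fx≡y))
    ... | inj₂ x∈W = ∈-++⁺ʳ τ (from (imgW y) (x , x∈W , Fx≡y))

  image-resp-↭ : ∀ {U τ σ} → IsImage F U τ → τ ↭ σ → IsImage F U σ
  image-resp-↭ img τ↭σ y = mk⇔ (to (img y) ∘ ∈-resp-↭ (↭-sym τ↭σ)) (∈-resp-↭ τ↭σ ∘ from (img y))

  map⁺-injectiveOn : ∀ {U} → InjectiveOn F U → Unique U → Unique (map F U)
  map⁺-injectiveOn {[]} _ [] = []
  map⁺-injectiveOn {x ∷ U} inj (x∉U ∷ uU) =
    Allₚ.map⁺ (All.tabulate λ y∈U Fx≡Fy → All.lookup x∉U y∈U (inj (here refl) (there y∈U) Fx≡Fy))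
    ∷ map⁺-injectiveOn (λ x∈U y∈U → inj (there x∈U) (there y∈U)) uU

  injectiveOn⇒length-image : ∀ {U τ} → IsImage F U τ → Unique U → Unique τ → InjectiveOn F U →
                             length τ ≡ length U
  injectiveOn⇒length-image {U} img uU uτ inj =
    trans (unique-⊆⊇⇒length-≡ uτ (map⁺-injectiveOn inj uU) (image⊆map img) (map⊆image img)) (length-map F U)

  -- Pigeonhole: were F x ≡ F y for distinct x, y, the image would fit into a list of length |W| - 1.
  length-image⇒injectiveOn : ∀ {W τ} → IsImage F W τ → Unique τ → length τ ≡ length W → InjectiveOn F W
  length-image⇒injectiveOn {W} {τ} img uτ |τ|≡|W| {x} x∈W y∈W Fx≡Fy with W′ , W↭ ← ∈⇒↭-∷ y∈W
    with ∈-resp-↭ W↭ x∈W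
  ... | here x≡y = x≡y
  ... | there x∈W′ = ⊥-elim (1+n≰n (subst (_≤ length (map F W′)) |τ|≡|W′|+1 (unique-⊆⇒length-≤ uτ τ⊆FW′)))
    where
    τ⊆FW′ : τ ⊆ map F W′
    τ⊆FW′ t∈τ with w , w∈W , refl ← to (img _) t∈τ with ∈-resp-↭ W↭ w∈W
    ... | here refl = subst (_∈ map F W′) Fx≡Fy (∈-map⁺ F x∈W′)
    ... | there w∈W′ = ∈-map⁺ F w∈W′
    |τ|≡|W′|+1 : length τ ≡ suc (length (map F W′))
    |τ|≡|W′|+1 = trans |τ|≡|W| (trans (↭-length W↭) (cong suc (sym (length-map F W′))))

  injectiveOn-image-⊇⇒⊇ : ∀ {U W τ σ} → InjectiveOn F W → U ⊆ W → IsImage F U τ → IsImage F W σ →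
                          σ ⊆ τ → W ⊆ U
  injectiveOn-image-⊇⇒⊇ {U} inj U⊆W imgU imgW σ⊆τ w∈W
    with u , u∈U , Fu≡Fw ← to (imgU _) (σ⊆τ (from (imgW _) (_ , w∈W , refl)))
    = subst (_∈ U) (inj (U⊆W u∈U) w∈W Fu≡Fw) u∈U

  module _ (c : B → A) (F∘c : ∀ y → F (c y) ≡ y) where

    image-map-section : ∀ zs → IsImage F (map c zs) zs
    image-map-section zs y = mk⇔ (λ y∈zs → c y , ∈-map⁺ c y∈zs , F∘c y) image←
      where
      image← : (∃ λ x → x ∈ map c zs × F x ≡ y) → y ∈ zs
      image← (x , x∈czs , refl) with z , z∈zs , refl ← ∈-map⁻ c x∈czs = subst (_∈ zs) (sym (F∘c z)) z∈zs

    section-extension-unique : ∀ {U τ zs} → IsImage F U τ → Unique U → Unique (τ ++ zs) →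
                               Unique (U ++ map c zs)
    section-extension-unique {U} {τ} imgU uU uτzs =
      Unique.++⁺ uU (Unique.map⁺ c-injective (proj₁ (unique-++⁻ τ uτzs))) U#czs
      where
      c-injective : ∀ {y y′} → c y ≡ c y′ → y ≡ y′
      c-injective {y} {y′} cy≡cy′ = trans (sym (F∘c y)) (trans (cong F cy≡cy′) (F∘c y′))
      U#czs : Disjoint U (map c _)
      U#czs (x∈U , x∈czs) with z , z∈zs , refl ← ∈-map⁻ c x∈czs =
        proj₂ (unique-++⁻ τ uτzs) (subst (_∈ τ) (F∘c z) (from (imgU _) (_ , x∈U , refl)) , z∈zs)

top-simplex-maximal : ∀ {d} (K : SimplicialComplex) → DimAtMost K d → ∀ {τ} → IsKSimplex K d τ → IsMaximal K τ
top-simplex-maximal K dimK (sτ , |τ|≡d+1) =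
  sτ , λ ρ sρ τ⊆ρ → unique-⊆-length-≤⇒⊇ (unique K _ sτ) τ⊆ρ (≤-trans (dimK ρ sρ) (≤-reflexive (sym |τ|≡d+1)))

module Fibration (d : ℕ) (X Y : SimplicialComplex) (F : V X → V Y) (C : V X → Set) where

  FiberedInTopDimension : Set
  FiberedInTopDimension =
    ∀ U → Unique U → length U ≡ suc d → Simplex X U ⇔ (ImageIsKSimplex X Y F d U × Meets U C)

  TopSimplicesLiftToCore : Set
  TopSimplicesLiftToCore =
    ∀ τ → IsKSimplex Y d τ → ∃ λ U → (∀ x → x ∈ U → C x) × IsImage F U τ

  FiberedCondition : ℕ → List (V X) → Set
  FiberedCondition k U = ImageIsKSimplex X Y F k U × (ImageIsMaximal X Y F U → Meets U C)

  core-covers-vertices : PureOfDim Y d → TopSimplicesLiftToCore →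
                         ∀ y → ∃ λ x → C x × F x ≡ y
  core-covers-vertices pureY lift y
    with τ , topτ , [y]⊆τ ← pureY [ y ] (vertex Y y)
    with U , U⊆C , imgU ← lift τ topτ
    with x , x∈U , Fx≡y ← to (imgU y) ([y]⊆τ (here refl))
    = x , U⊆C x x∈U , Fx≡y

  simplex⇒image-condition : PureOfDim X d → IsSimplicialMap X Y F → FiberedInTopDimension →
    ∀ {k U} → Unique U → length U ≡ suc k → Simplex X U → FiberedCondition k U
  simplex⇒image-condition pureX simp top {U = U} uU |U|≡k+1 sU
    with W , (sW , |W|≡d+1) , U⊆W ← pureX U sU
    with (σ , imgW , sσ , |σ|≡d+1) , (w , w∈W , Cw) ← to (top W (unique X W sW) |W|≡d+1) sW
    with τ , imgU , sτ ← simp U sU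
    = (τ , imgU , sτ , trans |τ|≡|U| |U|≡k+1) , maximal⇒meets
    where
    injW : InjectiveOn F W
    injW = length-image⇒injectiveOn F imgW (unique Y σ sσ) (trans |σ|≡d+1 (sym |W|≡d+1))
    injU : InjectiveOn F U
    injU x∈U y∈U = injW (U⊆W x∈U) (U⊆W y∈U)
    |τ|≡|U| : length τ ≡ length U
    |τ|≡|U| = injectiveOn⇒length-image F imgU uU (unique Y τ sτ) injU
    maximal⇒meets : ImageIsMaximal X Y F U → Meets U C
    maximal⇒meets (ϕ , imgϕ , _ , ϕ-maximal) = w , W⊆U w∈W , Cw
      where
      W⊆U : W ⊆ U
      W⊆U = injectiveOn-image-⊇⇒⊇ F injW U⊆W imgϕ imgW (ϕ-maximal σ sσ (image-mono F imgϕ imgW U⊆W))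

  image-condition⇒simplex : DimAtMost Y d → PureOfDim Y d → FiberedInTopDimension →
    (c : V Y → V X) → (∀ y → C (c y)) → (∀ y → F (c y) ≡ y) →
    ∀ {k U} → Unique U → length U ≡ suc k → FiberedCondition k U → Simplex X U
  image-condition⇒simplex dimY pureY top c C∘c F∘c {U = U} uU |U|≡k+1
    ((τ , imgU , sτ , |τ|≡k+1) , maximal⇒meets)
    with ρ , (sρ , |ρ|≡d+1) , τ⊆ρ ← pureY τ sτ
    with ⊆⇒↭-++ (unique Y τ sτ) τ⊆ρ
  ... | [] , ρ↭τ =
    from (top U uU (trans |U|≡|τ| |τ|≡d+1)) ((τ , imgU , sτ , |τ|≡d+1) , maximal⇒meets (τ , imgU , τ-maximal))
    where
    open ≡-Reasoning
    |τ|≡d+1 : length τ ≡ suc d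
    |τ|≡d+1 = begin
      length τ      ≡⟨ sym (+-identityʳ (length τ)) ⟩
      length τ + 0  ≡⟨ sym (length-↭-++ τ ρ↭τ) ⟩
      length ρ      ≡⟨ |ρ|≡d+1 ⟩
      suc d         ∎
    |U|≡|τ| : length U ≡ length τ
    |U|≡|τ| = trans |U|≡k+1 (sym |τ|≡k+1)
    τ-maximal : IsMaximal Y τ
    τ-maximal = top-simplex-maximal Y dimY (sτ , |τ|≡d+1)
  ... | z ∷ zs , ρ↭τ++zs =
    face X W U uU (subst (0 <_) (sym |U|≡k+1) z<s) ∈-++⁺ˡ
      (from (top W uW |W|≡d+1) ((ρ , imgW , sρ , |ρ|≡d+1) , (c z , ∈-++⁺ʳ U (here refl) , C∘c z)))
    where
    open ≡-Reasoning
    W : List (V X)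
    W = U ++ map c (z ∷ zs)
    uW : Unique W
    uW = section-extension-unique F c F∘c imgU uU (unique-resp-↭ ρ↭τ++zs (unique Y ρ sρ))
    imgW : IsImage F W ρ
    imgW = image-resp-↭ F (image-++ F imgU (image-map-section F c F∘c (z ∷ zs))) (↭-sym ρ↭τ++zs)
    |W|≡d+1 : length W ≡ suc d
    |W|≡d+1 = begin
      length W                               ≡⟨ length-++ U ⟩
      length U + length (map c (z ∷ zs))     ≡⟨ cong₂ _+_ (trans |U|≡k+1 (sym |τ|≡k+1)) (length-map c (z ∷ zs)) ⟩
      length τ + length (z ∷ zs)             ≡⟨ sym (length-↭-++ τ ρ↭τ++zs) ⟩
      length ρ                               ≡⟨ |ρ|≡d+1 ⟩
      suc d                                  ∎

lemma2p22 : (d : ℕ) (X Y : SimplicialComplex) →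
    DimAtMost X d → PureOfDim X d → DimAtMost Y d → PureOfDim Y d →
    (F : V X → V Y) → IsSimplicialMap X Y F → (C : V X → Set) →
    (∀ (U : List (V X)) → Unique U → length U ≡ suc d →
       Simplex X U ⇔ (ImageIsKSimplex X Y F d U × Meets U C)) →
    (∀ (τ : List (V Y)) → IsKSimplex Y d τ →
       ∃ λ U → (∀ x → x ∈ U → C x) × IsImage F U τ) →
    FiberedWithCore X Y F C
lemma2p22 d X Y _ pureX dimY pureY F simp C top lift = covers , fibered
  where
  open Fibration d X Y F C
  covers : ∀ y → ∃ λ x → C x × F x ≡ y
  covers = core-covers-vertices pureY lift
  fibered : ∀ k U → Unique U → length U ≡ suc k → Simplex X U ⇔ FiberedCondition k U
  fibered k U uU |U|≡k+1 = mk⇔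
    (simplex⇒image-condition pureX simp top uU |U|≡k+1)
    (image-condition⇒simplex dimY pureY top (proj₁ ∘ covers) (proj₁ ∘ proj₂ ∘ covers)
      (proj₂ ∘ proj₂ ∘ covers) uU |U|≡k+1)
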